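{- Let $G$ be a graph and let $B$ be a PSD forcing set of $G$ with $|B|=k$. Let $C_1,C_2,\ldots,C_m$ be the connected components of $G-B$, indexed so that $\mathrm{pt}_+(G[V(C_i)\cup B];B)\leq \mathrm{pt}_+(G[V(C_{i+1})\cup B];B)$ for $i=1,\ldots,m-1$, where, when $G-B$ is connected, one uses the convention $C_1=\emptyset$ and $C_2=G-B$ (so $m=2$). If $B$ is $k$-efficient, then \[\mathrm{pt}_+(G[V(C_{m})\cup B];B)-\mathrm{pt}_+(G[V(C_{m-1})\cup B];B)\leq 1.\]
   Context: Graphs are finite and simple. PSD color change rule: let $B$ be the current set of blue vertices and let $W_1,\dots,W_r$ be the vertex sets of the components of $G-B$; if $u\in B$, $w\in W_i$, and $w$ is the only white neighbor of $u$ in $G[W_i\cup B]$, then $w$ may be colored blue. $B$ is a PSD forcing set if repeated application from exactly $B$ blue colors all vertices. For a graph $H$ and $B\subseteq V(H)$: $B^{[0]}=B$, $B^{[i+1]}$ is $B^{[i]}$ together with all vertices that can be PSD forced when exactly $B^{[i]}$ is blue, and $\mathrm{pt}_+(H;B)$ is the least $t$ with $B^{[t]}=V(H)$. $\mathrm{pt}_+(G,k)=\min_{|B|=k}\mathrm{pt}_+(G;B)$. A PSD forcing set $B$ with $|B|=k$ is $k$-efficient if $\mathrm{pt}_+(G;B)=\mathrm{pt}_+(G,k)$. -}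

module Defs where

open import Data.Nat using (ℕ; zero; suc; _≤_)
open import Data.Fin using (Fin)
open import Data.Fin.Subset using (Subset; _∈_; _∉_; ∣_∣)
open import Data.Bool using (Bool; true; false)
open import Data.Product using (Σ; ∃; _×_; _,_)
open import Data.Sum using (_⊎_)
open import Data.Unit using (⊤)
open import Relation.Nullary using (¬_)
open import Relation.Binary.PropositionalEquality using (_≡_)

record Graph (n : ℕ) : Set where
  field
    adj   : Fin n → Fin n → Bool
    sym   : ∀ u v → adj u v ≡ adj v u
    irrefl : ∀ v → adj v v ≡ false

open Graph public

VSet : ℕ → Set₁
VSet n = Fin n → Set

module _ {n : ℕ} (G : Graph n) where

  Adj : Fin n → Fin n → Set
  Adj u v = adj G u v ≡ true

  data Walk (W : VSet n) : Fin n → Fin n → Set where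
    here : ∀ {x} → W x → Walk W x x
    step : ∀ {x y z} → W x → Adj x y → Walk W y z → Walk W x z

  -- Everything below is computed in the induced subgraph G[S].
  module _ (S : VSet n) where

    White : VSet n → VSet n
    White Bl v = S v × ¬ Bl v

    SameComp : VSet n → Fin n → Fin n → Set
    SameComp Bl w x = Walk (White Bl) w x

    -- PSD colour change rule in G[S] with blue set Bl: some blue u has w
    -- as its only white neighbour inside the component of G[S]-Bl containing w.
    CanForce : VSet n → Fin n → Set
    CanForce Bl w =
      White Bl w ×
      Σ (Fin n) λ u → S u × Bl u × Adj u w ×
        (∀ x → White Bl x → Adj u x → SameComp Bl w x → x ≡ w)

    BlueAt : Subset n → ℕ → VSet n
    BlueAt B zero v = v ∈ B
    BlueAt B (suc t) v = BlueAt B t v ⊎ CanForce (BlueAt B t) v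

    AllBlue : Subset n → ℕ → Set
    AllBlue B t = ∀ v → S v → BlueAt B t v

    IsPSDForcing : Subset n → Set
    IsPSDForcing B = ∃ λ t → AllBlue B t

    IsPT : Subset n → ℕ → Set
    IsPT B t = AllBlue B t × (∀ s → AllBlue B s → t ≤ s)

  Full : VSet n
  Full _ = ⊤

  -- B is k-efficient in G: a PSD forcing set with |B| = k whose propagation
  -- time equals pt_+(G,k) = min over |B'| = k of pt_+(G;B')
  -- (non-forcing B' have infinite propagation time).
  KEfficient : ℕ → Subset n → Set
  KEfficient k B =
    ∣ B ∣ ≡ k × IsPSDForcing Full B ×
    (∀ (B' : Subset n) → ∣ B' ∣ ≡ k → ∀ t t' →
       IsPT Full B t → IsPT Full B' t' → t ≤ t')

  ConnOut : Subset n → Fin n → Fin n → Set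
  ConnOut B x y = Walk (λ v → v ∉ B) x y

  CompPlusB : Subset n → Fin n → VSet n
  CompPlusB B x v = v ∈ B ⊎ ConnOut B x v

{-# OPTIONS --safe #-}
-- Suppose the component C of G − B containing x needs 2 + s rounds while every
-- other component is done after s rounds.  Let F ⊆ C be the vertices forced in
-- round one; their forcers lie in B and are pairwise distinct.  Exchanging each
-- w ∈ F with its forcer gives a set B′ of the same size from which C is blue one
-- round earlier, the exchanged forcers are forced back by their partners in
-- round one, and the other components are merely delayed by one round.  So B′
-- finishes after 1 + s rounds, contradicting the k-efficiency of B, whose
-- propagation time is at least 2 + s.
module Submission where

open import Defs hiding (sym)
open import Level using (0ℓ)
open import Data.Nat using (ℕ; zero; suc; _≤_; _<_; _+_; z≤n; s≤s; _≤′_; ≤′-refl; ≤′-step)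
open import Data.Nat.Properties
  using (≤-trans; <-≤-trans; ≤⇒≤′; ≤-pred; ≰⇒>; 1+n≰n; +-comm; +-0-commutativeMonoid; _≤?_)
open import Data.Fin using (Fin; zero; suc; _≟_)
open import Data.Fin.Properties using (any?; all?)
open import Data.Fin.Subset using (Subset; _∈_; _∉_; ∣_∣; _-_; ⊤)
open import Data.Fin.Subset.Properties
  using (_∈?_; ∈⊤; ∣p∣≤n; p─q⊆p; x∈p∧x≢y⇒x∈p-y; x∈p⇒∣p-x∣<∣p∣)
open import Data.Fin.Permutation using (Permutation; _⟨$⟩ʳ_; permutation)
open import Data.Bool using (true; false; if_then_else_) renaming (_≟_ to _≟ᵇ_)
open import Data.Vec using ([]; _∷_; lookup; tabulate)
open import Data.Vec.Properties using (lookup∘tabulate; []=⇒lookup; lookup⇒[]=)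
open import Data.Product using (Σ; ∃; _×_; _,_; proj₁; proj₂)
open import Data.Sum using (_⊎_; inj₁; inj₂)
open import Data.Unit using (tt)
open import Data.Empty using (⊥; ⊥-elim)
open import Function using (_∘_; _⇔_; mk⇔; Equivalence; case_of_)
open import Relation.Unary using (Pred; Decidable)
open import Relation.Nullary using (¬_; Dec; yes; no)
open import Relation.Nullary.Decidable using (_×-dec_; _⊎-dec_; _→-dec_; ¬?; map′)
open import Relation.Binary.PropositionalEquality using (_≡_; refl; sym; trans; cong; subst; module ≡-Reasoning)
open import Algebra.Properties.CommutativeMonoid.Sum +-0-commutativeMonoid
  using (sum; sum-cong-≗; sum-permute)

open Equivalence using (to; from)

Least : Pred ℕ 0ℓ → ℕ → Set
Least P t = P t × (∀ s → P s → t ≤ s)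

least-witness : {P : Pred ℕ 0ℓ} → Decidable P → ∀ {T} → P T → Σ ℕ (Least P)
least-witness P? pT with P? 0
... | yes p0 = 0 , p0 , λ _ _ → z≤n
least-witness P? {zero} pT | no ¬p0 = ⊥-elim (¬p0 pT)
least-witness {P} P? {suc T} pT | no ¬p0 with least-witness {P ∘ suc} (P? ∘ suc) pT
... | t , pt , minimal = suc t , pt , λ where
  zero p0 → ⊥-elim (¬p0 p0)
  (suc s) ps → s≤s (minimal s ps)

preimage : ∀ {n} → (Fin n → Fin n) → Subset n → Subset n
preimage f p = tabulate (lookup p ∘ f)

∈-preimage⁺ : ∀ {n} {f : Fin n → Fin n} {p v} → f v ∈ p → v ∈ preimage f p
∈-preimage⁺ {f = f} {p} {v} fv∈p =
  lookup⇒[]= v _ (trans (lookup∘tabulate (lookup p ∘ f) v) ([]=⇒lookup fv∈p))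

indicator : ∀ {n} → Subset n → Fin n → ℕ
indicator p i = if lookup p i then 1 else 0

∣p∣≡sum : ∀ {n} (p : Subset n) → ∣ p ∣ ≡ sum (indicator p)
∣p∣≡sum [] = refl
∣p∣≡sum (true ∷ p) = cong suc (∣p∣≡sum p)
∣p∣≡sum (false ∷ p) = ∣p∣≡sum p

∣preimage∣ : ∀ {n} (π : Permutation n n) (p : Subset n) → ∣ preimage (π ⟨$⟩ʳ_) p ∣ ≡ ∣ p ∣
∣preimage∣ π p = begin
  ∣ preimage (π ⟨$⟩ʳ_) p ∣                  ≡⟨ ∣p∣≡sum (preimage (π ⟨$⟩ʳ_) p) ⟩
  sum (indicator (preimage (π ⟨$⟩ʳ_) p))    ≡⟨ sum-cong-≗ (cong (if_then 1 else 0) ∘ lookup∘tabulate (lookup p ∘ (π ⟨$⟩ʳ_))) ⟩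
  sum (indicator p ∘ (π ⟨$⟩ʳ_))             ≡⟨ sum-permute (indicator p) π ⟨
  sum (indicator p)                         ≡⟨ ∣p∣≡sum p ⟨
  ∣ p ∣                                     ∎
  where open ≡-Reasoning

module Swap {n : ℕ} {F : Pred (Fin n) 0ℓ} (F? : Decidable F) (r : Fin n → Fin n)
            (r-∉F : ∀ {w} → F w → ¬ F (r w))
            (r-injective : ∀ {w w′} → F w → F w′ → r w ≡ r w′ → w ≡ w′) where

  Matched : Pred (Fin n) 0ℓ
  Matched v = ∃ λ w → F w × r w ≡ v

  Matched? : Decidable Matched
  Matched? v = any? λ w → F? w ×-dec r w ≟ v

  swap : Fin n → Fin n
  swap v with F? v | Matched? v
  ... | yes _ | _ = r v
  ... | no _ | yes (w , _) = w
  ... | no _ | no _ = v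

  swap-F : ∀ {v} → F v → swap v ≡ r v
  swap-F {v} fv with F? v | Matched? v
  ... | yes _ | _ = refl
  ... | no ¬fv | _ = ⊥-elim (¬fv fv)

  swap-matched : ∀ {w} → F w → swap (r w) ≡ w
  swap-matched {w} fw with F? (r w) | Matched? (r w)
  ... | yes frw | _ = ⊥-elim (r-∉F fw frw)
  ... | no _ | yes (w′ , fw′ , rw′≡rw) = r-injective fw′ fw rw′≡rw
  ... | no _ | no ¬m = ⊥-elim (¬m (w , fw , refl))

  swap-fixed : ∀ {v} → ¬ F v → ¬ Matched v → swap v ≡ v
  swap-fixed {v} ¬fv ¬mv with F? v | Matched? v
  ... | yes fv | _ = ⊥-elim (¬fv fv)
  ... | no _ | yes mv = ⊥-elim (¬mv mv)
  ... | no _ | no _ = refl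

  swap-involutive : ∀ v → swap (swap v) ≡ v
  swap-involutive v = by-cases (F? v) (Matched? v)
    where
    by-cases : Dec (F v) → Dec (Matched v) → swap (swap v) ≡ v
    by-cases (yes fv) _ = trans (cong swap (swap-F fv)) (swap-matched fv)
    by-cases (no _) (yes (w , fw , refl)) = trans (cong swap (swap-matched fw)) (swap-F fw)
    by-cases (no ¬fv) (no ¬mv) = trans (cong swap (swap-fixed ¬fv ¬mv)) (swap-fixed ¬fv ¬mv)

  swap-permutation : Permutation n n
  swap-permutation = permutation swap swap swap-involutive swap-involutive

module _ {n : ℕ} (G : Graph n) where

  Adj-sym : ∀ {u v} → Adj G u v → Adj G v u
  Adj-sym {u} {v} = trans (Graph.sym G v u)

  Adj? : ∀ u v → Dec (Adj G u v)
  Adj? u v = adj G u v ≟ᵇ true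

  Full? : Decidable (Full G)
  Full? _ = yes tt

  walk-map : ∀ {W W′ : VSet n} → (∀ {v} → W v → W′ v) → ∀ {a b} → Walk G W a b → Walk G W′ a b
  walk-map f (here w) = here (f w)
  walk-map f (step w ad r) = step (f w) ad (walk-map f r)

  walk-first : ∀ {W a b} → Walk G W a b → W a
  walk-first (here w) = w
  walk-first (step w _ _) = w

  walk-last : ∀ {W a b} → Walk G W a b → W b
  walk-last (here w) = w
  walk-last (step _ _ r) = walk-last r

  walk-snoc : ∀ {W a b c} → Walk G W a b → Adj G b c → W c → Walk G W a c
  walk-snoc (here w) bc wc = step w bc (here wc)
  walk-snoc (step w ad r) bc wc = step w ad (walk-snoc r bc wc)

  walk-++ : ∀ {W a b c} → Walk G W a b → Walk G W b c → Walk G W a c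
  walk-++ (here _) r = r
  walk-++ (step w ad r) r′ = step w ad (walk-++ r r′)

  walk-reverse : ∀ {W a b} → Walk G W a b → Walk G W b a
  walk-reverse (here w) = here w
  walk-reverse (step w ad r) = walk-snoc (walk-reverse r) (Adj-sym ad) w

  module _ {W : VSet n} (W? : Decidable W) where

    private
      Within : Subset n → VSet n
      Within A v = W v × v ∈ A

      avoiding-or-after : ∀ {A} a {c b} → Walk G (Within A) c b →
        Walk G (Within (A - a)) c b ⊎ (a ≡ b ⊎ ∃ λ z → Adj G a z × Walk G (Within (A - a)) z b)
      avoiding-or-after a (here {c} (wc , c∈A)) with c ≟ a
      ... | yes refl = inj₂ (inj₁ refl)
      ... | no c≢a = inj₁ (here (wc , x∈p∧x≢y⇒x∈p-y c∈A c≢a))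
      avoiding-or-after a (step {c} {d} (wc , c∈A) cd r) with avoiding-or-after a r
      ... | inj₂ after = inj₂ after
      ... | inj₁ r′ with c ≟ a
      ...   | yes refl = inj₂ (inj₂ (d , cd , r′))
      ...   | no c≢a = inj₁ (step (wc , x∈p∧x≢y⇒x∈p-y c∈A c≢a) cd r′)

      leaving : ∀ {A a b} → Walk G (Within A) a b →
        a ≡ b ⊎ ∃ λ z → Adj G a z × Walk G (Within (A - a)) z b
      leaving (here _) = inj₁ refl
      leaving {a = a} (step _ ad r) with avoiding-or-after a r
      ... | inj₁ r′ = inj₂ (_ , ad , r′)
      ... | inj₂ after = after

      Walk-within? : ∀ m (A : Subset n) → ∣ A ∣ < m → ∀ a b → Dec (Walk G (Within A) a b)
      Walk-within? (suc m) A (s≤s ∣A∣≤m) a b with W? a ×-dec a ∈? A | a ≟ b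
      ... | no a∉ | _ = no (a∉ ∘ walk-first)
      ... | yes a∈ | yes refl = yes (here a∈)
      ... | yes a∈@(_ , a∈A) | no a≢b = map′ extend shorten
        (any? λ z → Adj? a z ×-dec Walk-within? m (A - a) (<-≤-trans (x∈p⇒∣p-x∣<∣p∣ a∈A) ∣A∣≤m) z b)
        where
        extend : (∃ λ z → Adj G a z × Walk G (Within (A - a)) z b) → Walk G (Within A) a b
        extend (_ , ad , r) = step a∈ ad (walk-map (λ (wv , v∈) → wv , p─q⊆p A _ v∈) r)
        shorten : Walk G (Within A) a b → ∃ λ z → Adj G a z × Walk G (Within (A - a)) z b
        shorten r with leaving r
        ... | inj₁ a≡b = ⊥-elim (a≢b a≡b)
        ... | inj₂ next = next

    -- Opaque, like the other decision procedures below: unfolding them inside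
    -- with-abstractions makes type checking very slow.
    opaque
      Walk? : ∀ a b → Dec (Walk G W a b)
      Walk? a b = map′ (walk-map proj₁) (walk-map (_, ∈⊤))
        (Walk-within? (suc n) ⊤ (s≤s (∣p∣≤n ⊤)) a b)

  ∈⇒BlueAt : ∀ {S B} t {v} → v ∈ B → BlueAt G S B t v
  ∈⇒BlueAt zero v∈B = v∈B
  ∈⇒BlueAt (suc t) v∈B = inj₁ (∈⇒BlueAt t v∈B)

  BlueAt-mono : ∀ {S B t t′ v} → t ≤ t′ → BlueAt G S B t v → BlueAt G S B t′ v
  BlueAt-mono = go ∘ ≤⇒≤′
    where
    go : ∀ {S B t t′ v} → t ≤′ t′ → BlueAt G S B t v → BlueAt G S B t′ v
    go ≤′-refl blue = blue
    go (≤′-step t≤′t′) blue = inj₁ (go t≤′t′ blue)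

  opaque
    CanForce? : ∀ {S X} → Decidable S → Decidable X → Decidable (CanForce G S X)
    CanForce? {S} {X} S? X? w = White? w ×-dec any? λ u →
      S? u ×-dec X? u ×-dec Adj? u w ×-dec
      all? λ z → White? z →-dec Adj? u z →-dec Walk? White? w z →-dec z ≟ w
      where
      White? : Decidable (White G S X)
      White? v = S? v ×-dec ¬? (X? v)

    BlueAt? : ∀ {S} → Decidable S → ∀ B t → Decidable (BlueAt G S B t)
    BlueAt? S? B zero v = v ∈? B
    BlueAt? S? B (suc t) v = BlueAt? S? B t v ⊎-dec CanForce? S? (BlueAt? S? B t) v

    AllBlue? : ∀ {S} → Decidable S → ∀ B → Decidable (AllBlue G S B)
    AllBlue? S? B t = all? λ v → S? v →-dec BlueAt? S? B t v

  pt-exists : ∀ {S B T} → Decidable S → AllBlue G S B T → Σ ℕ (IsPT G S B)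
  pt-exists {B = B} S? = least-witness (AllBlue? S? B)

  -- Shrinking the white set can only shrink the white components.
  forced-mono : ∀ {S} {X Y : VSet n} → Decidable Y → (∀ {v} → X v → Y v) →
    ∀ {v} → X v ⊎ CanForce G S X v → Y v ⊎ CanForce G S Y v
  forced-mono Y? X⊆Y (inj₁ xv) = inj₁ (X⊆Y xv)
  forced-mono {S} {X} {Y} Y? X⊆Y {v} (inj₂ ((sv , _) , u , su , xu , uv , unique)) with Y? v
  ... | yes yv = inj₁ yv
  ... | no ¬yv = inj₂ ((sv , ¬yv) , u , su , X⊆Y xu , uv ,
          λ z wz uz vz → unique z (whiter wz) uz (walk-map whiter vz))
    where
    whiter : ∀ {z} → White G S Y z → White G S X z
    whiter (sz , ¬yz) = sz , ¬yz ∘ X⊆Y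

  BlueAt-delay : ∀ {S B B′ d} → Decidable S → (∀ {v} → v ∈ B → BlueAt G S B′ d v) →
    ∀ t {v} → BlueAt G S B t v → BlueAt G S B′ (t + d) v
  BlueAt-delay S? B⊆ zero = B⊆
  BlueAt-delay {B′ = B′} {d} S? B⊆ (suc t) =
    forced-mono (BlueAt? S? B′ (t + d)) (BlueAt-delay S? B⊆ t)

  -- A white walk of G starting in S stays in S, since S consists of B and whole
  -- components of G − B.
  module Induced {S : VSet n} {B : Subset n} (B⊆S : ∀ {v} → v ∈ B → S v)
                 (closed : ∀ {u v} → S u → u ∉ B → v ∉ B → Adj G u v → S v) where

    private
      P Q : ℕ → VSet n
      P = BlueAt G (Full G) B
      Q = BlueAt G S B

      white-∉B : ∀ {t v} → ¬ P t v → v ∉ B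
      white-∉B {t} ¬pv = ¬pv ∘ ∈⇒BlueAt t

      white-walk-stays : ∀ {t} → (∀ {v} → S v → Q t v ⇔ P t v) →
        ∀ {a b} → Walk G (White G (Full G) (P t)) a b → S a → Walk G (White G S (Q t)) a b
      white-walk-stays eqv (here (_ , ¬pa)) sa = here (sa , ¬pa ∘ to (eqv sa))
      white-walk-stays eqv (step (_ , ¬pa) ac r) sa =
        step (sa , ¬pa ∘ to (eqv sa)) ac
             (white-walk-stays eqv r (closed sa (white-∉B ¬pa) (white-∉B (proj₂ (walk-first r))) ac))

    BlueAt-induced : ∀ t {v} → S v → Q t v ⇔ P t v
    BlueAt-induced zero _ = mk⇔ (λ q → q) (λ p → p)
    BlueAt-induced (suc t) {v} sv = mk⇔ Q⇒P P⇒Q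
      where
      eqv : ∀ {v} → S v → Q t v ⇔ P t v
      eqv = BlueAt-induced t
      Q⇒P : Q (suc t) v → P (suc t) v
      Q⇒P (inj₁ q) = inj₁ (to (eqv sv) q)
      Q⇒P (inj₂ ((_ , ¬qv) , u , su , qu , uv , unique)) =
        inj₂ ((tt , ¬qv ∘ from (eqv sv)) , u , tt , to (eqv su) qu , uv ,
              λ z _ uz vz → unique z (walk-last (white-walk-stays eqv vz sv)) uz
                                     (white-walk-stays eqv vz sv))
      P⇒Q : P (suc t) v → Q (suc t) v
      P⇒Q (inj₁ p) = inj₁ (from (eqv sv) p)
      P⇒Q (inj₂ ((_ , ¬pv) , u , _ , pu , uv , unique)) =
        inj₂ ((sv , ¬pv ∘ to (eqv sv)) , u , su , from (eqv su) pu , uv ,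
              λ z (sz , ¬qz) uz vz → unique z (tt , ¬qz ∘ from (eqv sz)) uz (walk-map unwhite vz))
        where
        su : S u
        su with u ∈? B
        ... | yes u∈B = B⊆S u∈B
        ... | no u∉B = closed sv (white-∉B ¬pv) u∉B (Adj-sym uv)
        unwhite : ∀ {z} → White G S (Q t) z → White G (Full G) (P t) z
        unwhite (sz , ¬qz) = tt , ¬qz ∘ from (eqv sz)

  module _ (B : Subset n) (y : Fin n) where

    CompPlusB? : Decidable (CompPlusB G B y)
    CompPlusB? v = v ∈? B ⊎-dec Walk? (λ v → ¬? (v ∈? B)) y v

    CompPlusB-closed : ∀ {u v} → CompPlusB G B y u → u ∉ B → v ∉ B → Adj G u v → CompPlusB G B y v
    CompPlusB-closed (inj₁ u∈B) u∉B _ _ = ⊥-elim (u∉B u∈B)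
    CompPlusB-closed (inj₂ yu) _ v∉B uv = inj₂ (walk-snoc yu uv v∉B)

    open Induced {CompPlusB G B y} {B} inj₁ CompPlusB-closed

    AllBlue-component : ∀ {t} → AllBlue G (Full G) B t → AllBlue G (CompPlusB G B y) B t
    AllBlue-component all v sv = from (BlueAt-induced _ sv) (all v tt)

    BlueAt-component⇒BlueAt : ∀ {t v} → CompPlusB G B y v →
      BlueAt G (CompPlusB G B y) B t v → BlueAt G (Full G) B t v
    BlueAt-component⇒BlueAt sv = to (BlueAt-induced _ sv)

    pt-component : IsPSDForcing G (Full G) B → Σ ℕ (IsPT G (CompPlusB G B y) B)
    pt-component (_ , allB) = pt-exists CompPlusB? (AllBlue-component allB)

    IsPT-component⇒BlueAt : ∀ {t} → y ∉ B → IsPT G (CompPlusB G B y) B t → BlueAt G (Full G) B t y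
    IsPT-component⇒BlueAt y∉B (allC , _) = BlueAt-component⇒BlueAt (inj₂ (here y∉B)) (allC y (inj₂ (here y∉B)))

  KEfficient⇒AllBlue : ∀ {k B B′ t} → KEfficient G k B → ∣ B′ ∣ ≡ k →
    AllBlue G (Full G) B′ t → AllBlue G (Full G) B t
  KEfficient⇒AllBlue {B = B} {B′} (_ , (_ , allB) , optimal) ∣B′∣≡k allB′ v _ =
    BlueAt-mono (≤-trans (optimal B′ ∣B′∣≡k _ _ ptB ptB′) (proj₂ ptB′ _ allB′)) (proj₁ ptB v tt)
    where
    ptB = proj₂ (pt-exists Full? allB)
    ptB′ = proj₂ (pt-exists Full? allB′)

  module FirstRoundSwap (B : Subset n) (x : Fin n) where

    InC : VSet n
    InC = ConnOut G B x

    InC? : Decidable InC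
    InC? = Walk? (λ v → ¬? (v ∈? B)) x

    InC⇒∉B : ∀ {v} → InC v → v ∉ B
    InC⇒∉B = walk-last

    InC-walk : ∀ {a b} → InC a → InC b → Walk G (White G (Full G) (BlueAt G (Full G) B 0)) a b
    InC-walk ca cb = walk-map (tt ,_) (walk-++ (walk-reverse ca) cb)

    Forced : VSet n
    Forced w = InC w × CanForce G (Full G) (BlueAt G (Full G) B 0) w

    Forced? : Decidable Forced
    Forced? w = InC? w ×-dec CanForce? Full? (BlueAt? Full? B 0) w

    forcer : Fin n → Fin n
    forcer w with Forced? w
    ... | yes (_ , _ , u , _) = u
    ... | no _ = w

    forcer-spec : ∀ {w} → Forced w →
      forcer w ∈ B × Adj G (forcer w) w × (∀ {z} → InC z → Adj G (forcer w) z → z ≡ w)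
    forcer-spec {w} fw with Forced? w
    ... | yes (cw , _ , u , _ , u∈B , uw , unique) =
          u∈B , uw , λ cz uz → unique _ (tt , InC⇒∉B cz) uz (InC-walk cw cz)
    ... | no ¬fw = ⊥-elim (¬fw fw)

    forcer∈B : ∀ {w} → Forced w → forcer w ∈ B
    forcer∈B = proj₁ ∘ forcer-spec

    forcer-adj : ∀ {w} → Forced w → Adj G (forcer w) w
    forcer-adj = proj₁ ∘ proj₂ ∘ forcer-spec

    forcer-unique : ∀ {w z} → Forced w → InC z → Adj G (forcer w) z → z ≡ w
    forcer-unique fw = proj₂ (proj₂ (forcer-spec fw))

    forcer-∉Forced : ∀ {w} → Forced w → ¬ Forced (forcer w)
    forcer-∉Forced fw (c , _) = InC⇒∉B c (forcer∈B fw)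

    forcer-injective : ∀ {w w′} → Forced w → Forced w′ → forcer w ≡ forcer w′ → w ≡ w′
    forcer-injective fw fw′ eq =
      sym (forcer-unique fw (proj₁ fw′) (subst (λ u → Adj G u _) (sym eq) (forcer-adj fw′)))

    open Swap Forced? forcer forcer-∉Forced forcer-injective

    B′ : Subset n
    B′ = preimage swap B

    ∣B′∣ : ∣ B′ ∣ ≡ ∣ B ∣
    ∣B′∣ = ∣preimage∣ swap-permutation B

    Forced⇒∈B′ : ∀ {v} → Forced v → v ∈ B′
    Forced⇒∈B′ fv = ∈-preimage⁺ (subst (_∈ B) (sym (swap-F fv)) (forcer∈B fv))

    ∉B′⇒Matched : ∀ {v} → v ∈ B → v ∉ B′ → Matched v
    ∉B′⇒Matched {v} v∈B v∉B′ with Matched? v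
    ... | yes mv = mv
    ... | no ¬mv = ⊥-elim (v∉B′ (∈-preimage⁺ (subst (_∈ B) (sym (swap-fixed ¬fv ¬mv)) v∈B)))
      where
      ¬fv : ¬ Forced v
      ¬fv (cv , _) = InC⇒∉B cv v∈B

    B-neighbour⇒∈B′ : ∀ {u v} → u ∈ B → InC v → v ∉ B′ → Adj G u v → u ∈ B′
    B-neighbour⇒∈B′ {u} u∈B cv v∉B′ uv with u ∈? B′
    ... | yes u∈B′ = u∈B′
    ... | no u∉B′ with ∉B′⇒Matched u∈B u∉B′
    ...   | w , fw , refl = ⊥-elim (v∉B′ (subst (_∈ B′) (sym (forcer-unique fw cv uv)) (Forced⇒∈B′ fw)))

    -- A white walk of the new colouring can leave C only through a vertex of
    -- B ∖ B′, i.e. through the forcer of some w ∈ F; but such a forcer has no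
    -- neighbour in C other than w, which is already blue.
    C-sealed : ∀ {Y : VSet n} → (∀ {v} → v ∈ B′ → Y v) →
      ∀ {a b} → Walk G (White G (Full G) Y) a b → InC a → Walk G (λ v → InC v × White G (Full G) Y v) a b
    C-sealed B′⊆Y (here wa) ca = here (ca , wa)
    C-sealed B′⊆Y (step {a} {c} wa ac r) ca = step (ca , wa) ac (C-sealed B′⊆Y r cc)
      where
      cc : InC c
      cc with c ∈? B
      ... | no c∉B = walk-snoc ca ac c∉B
      ... | yes c∈B = ⊥-elim (proj₂ (walk-first r)
              (B′⊆Y (B-neighbour⇒∈B′ c∈B ca (proj₂ wa ∘ B′⊆Y) (Adj-sym ac))))

    private
      P P′ : ℕ → VSet n
      P = BlueAt G (Full G) B
      P′ = BlueAt G (Full G) B′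

    C-one-round-earlier : ∀ t {v} → InC v → P (suc t) v → P′ t v
    C-one-round-earlier zero cv (inj₁ v∈B) = ⊥-elim (InC⇒∉B cv v∈B)
    C-one-round-earlier zero cv (inj₂ cf) = Forced⇒∈B′ (cv , cf)
    C-one-round-earlier (suc t) cv (inj₁ pv) = inj₁ (C-one-round-earlier t cv pv)
    C-one-round-earlier (suc t) {v} cv (inj₂ ((_ , ¬pv) , u , _ , pu , uv , unique))
      with BlueAt? Full? B′ t v
    ... | yes p′v = inj₁ p′v
    ... | no ¬p′v = inj₂ ((tt , ¬p′v) , u , tt , p′u , uv ,
            λ z _ uz vz → unique z (walk-last (old-white vz)) uz (old-white vz))
      where
      p′u : P′ t u
      p′u with u ∈? B
      ... | yes u∈B = ∈⇒BlueAt t (B-neighbour⇒∈B′ u∈B cv (¬p′v ∘ ∈⇒BlueAt t) uv)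
      ... | no u∉B = C-one-round-earlier t (walk-snoc cv (Adj-sym uv) u∉B) pu
      old-white : ∀ {z} → Walk G (White G (Full G) (P′ t)) v z → Walk G (White G (Full G) (P (suc t))) v z
      old-white vz = walk-map (λ (ca , _ , ¬p′a) → tt , ¬p′a ∘ C-one-round-earlier t ca)
                              (C-sealed (∈⇒BlueAt t) vz cv)

    -- The forcer of w ∈ F is forced back by w: the white neighbours of w in C
    -- lie in another white component, and no other forcer is adjacent to w.
    B-blue-after-one-round : ∀ {v} → v ∈ B → P′ 1 v
    B-blue-after-one-round {v} v∈B with v ∈? B′
    ... | yes v∈B′ = inj₁ v∈B′
    ... | no v∉B′ with ∉B′⇒Matched v∈B v∉B′
    ...   | w , fw , refl = inj₂ ((tt , v∉B′) , w , tt , Forced⇒∈B′ fw , Adj-sym (forcer-adj fw) ,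
              λ z (_ , z∉B′) wz vz → only-white-neighbour z∉B′ wz vz)
      where
      only-white-neighbour : ∀ {z} → z ∉ B′ → Adj G w z →
        Walk G (White G (Full G) (P′ 0)) (forcer w) z → z ≡ forcer w
      only-white-neighbour {z} z∉B′ wz vz with z ∈? B
      ... | no z∉B = ⊥-elim (InC⇒∉B (proj₁ (walk-last (C-sealed (λ b → b) (walk-reverse vz) cz))) v∈B)
        where
        cz : InC z
        cz = walk-snoc (proj₁ fw) wz z∉B
      ... | yes z∈B with ∉B′⇒Matched z∈B z∉B′
      ...   | w′ , fw′ , refl = cong forcer (sym (forcer-unique fw′ (proj₁ fw) (Adj-sym wz)))

    swap-speedup : ∀ s → (∀ {v} → InC v → P (2 + s) v) → (∀ {v} → v ∉ B → ¬ InC v → P s v) →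
      AllBlue G (Full G) B′ (suc s)
    swap-speedup s blueC blueRest v _ with InC? v | v ∈? B
    ... | yes cv | _ = C-one-round-earlier (suc s) cv (blueC cv)
    ... | no _ | yes v∈B = BlueAt-mono (s≤s z≤n) (B-blue-after-one-round v∈B)
    ... | no ¬cv | no v∉B = subst (λ t → P′ t v) (+-comm s 1)
          (BlueAt-delay Full? B-blue-after-one-round s (blueRest v∉B ¬cv))

  no-lag-of-two : ∀ {k B} x s → KEfficient G k B → IsPT G (CompPlusB G B x) B (2 + s) →
    (∀ {v} → v ∉ B → ¬ ConnOut G B x v → BlueAt G (Full G) B s v) → ⊥
  no-lag-of-two {B = B} x s efficient@(∣B∣≡k , _) (allC , minimal) blueRest =
    1+n≰n (minimal (suc s) (AllBlue-component B x allB))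
    where
    open FirstRoundSwap B x
    blueC : ∀ {v} → InC v → BlueAt G (Full G) B (2 + s) v
    blueC cv = BlueAt-component⇒BlueAt B x (inj₂ cv) (allC _ (inj₂ cv))
    allB : AllBlue G (Full G) B (suc s)
    allB = KEfficient⇒AllBlue efficient (trans ∣B′∣ ∣B∣≡k) (swap-speedup s blueC blueRest)

theorem3p4 : ∀ (n : ℕ) (G : Graph n) (k : ℕ) (B : Subset n) →
    ∣ B ∣ ≡ k → IsPSDForcing G (Full G) B → KEfficient G k B →
    ∀ (x : Fin n) (tx : ℕ) → x ∉ B →
    IsPT G (CompPlusB G B x) B tx →
    (∀ (y : Fin n) (ty : ℕ) → y ∉ B → IsPT G (CompPlusB G B y) B ty → ty ≤ tx) →
    (Σ (Fin n) λ y → Σ ℕ λ ty →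
       y ∉ B × ¬ ConnOut G B x y × IsPT G (CompPlusB G B y) B ty × tx ≤ suc ty)
    ⊎ ((∀ (y : Fin n) → y ∉ B → ConnOut G B x y) × tx ≤ 1)
theorem3p4 n G k B _ forcing efficient x tx _ ptx _ =
  case any? (λ y → (¬? (y ∈? B) ×-dec ¬? (InC? y)) ×-dec tx ≤? suc (pt y)) of λ where
    (yes (y , (y∉B , y∉C) , tx≤)) → inj₁ (y , pt y , y∉B , y∉C , proj₂ (ptC y) , tx≤)
    (no ¬near) → inj₂ (all-in-C ¬near , ≤1-if-far ptx ¬near)
  where
  open FirstRoundSwap G B x
  ptC : ∀ y → Σ ℕ (IsPT G (CompPlusB G B y) B)
  ptC y = pt-component G B y forcing
  pt : Fin n → ℕ
  pt = proj₁ ∘ ptC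
  Far : ℕ → Set
  Far t = ¬ ∃ λ y → (y ∉ B × ¬ InC y) × t ≤ suc (pt y)
  ≤1-if-far : ∀ {t} → IsPT G (CompPlusB G B x) B t → Far t → t ≤ 1
  ≤1-if-far {zero} _ _ = z≤n
  ≤1-if-far {suc zero} _ _ = s≤s z≤n
  ≤1-if-far {suc (suc s)} ptx far = ⊥-elim (no-lag-of-two G x s efficient ptx λ v∉B ¬cv →
    BlueAt-mono G (pt≤s v∉B ¬cv) (IsPT-component⇒BlueAt G B _ v∉B (proj₂ (ptC _))))
    where
    pt≤s : ∀ {v} → v ∉ B → ¬ InC v → pt v ≤ s
    pt≤s v∉B ¬cv = ≤-pred (≤-pred (≰⇒> λ le → far (_ , (v∉B , ¬cv) , le)))
  all-in-C : Far tx → ∀ y → y ∉ B → ConnOut G B x y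
  all-in-C far y y∉B with InC? y
  ... | yes cy = cy
  ... | no ¬cy = ⊥-elim (far (y , (y∉B , ¬cy) , ≤-trans (≤1-if-far ptx far) (s≤s z≤n)))
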